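{- For all formulas $\varphi,\psi$ of $\mathsf L$, the following formulas are valid over the class of all intuitionistic dynamic models: (1) $(\varphi\,\mathsf U\,\psi)\leftrightarrow\psi\vee(\varphi\wedge\bigcirc(\varphi\,\mathsf U\,\psi))$; (2) $(\varphi\,\mathsf R\,\psi)\leftrightarrow\psi\wedge(\varphi\vee\bigcirc(\varphi\,\mathsf R\,\psi))$; (3) $(\varphi\,\mathsf U\,\psi)\to\Diamond\psi$; (4) $\Box\psi\to(\varphi\,\mathsf R\,\psi)$; (5) $\Diamond\varphi\leftrightarrow(\top\,\mathsf U\,\varphi)$; (6) $\Box\varphi\leftrightarrow(\bot\,\mathsf R\,\varphi)$; (7) $\bigcirc(\varphi\,\mathsf U\,\psi)\leftrightarrow(\bigcirc\varphi)\,\mathsf U\,(\bigcirc\psi)$; (8) $\bigcirc(\varphi\,\mathsf R\,\psi)\leftrightarrow(\bigcirc\varphi)\,\mathsf R\,(\bigcirc\psi)$; (9) $\varphi\,\mathsf U\,\psi\leftrightarrow(\psi\,\mathsf R\,(\varphi\vee\psi))\wedge\Diamond\psi$; (10) $\varphi\,\mathsf R\,\psi\leftrightarrow(\psi\,\mathsf U\,(\varphi\wedge\psi))\vee\Box\psi$.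
   Context: Formulas of $\mathsf L$: $p \mid \bot \mid \wedge \mid \vee \mid \to \mid \bigcirc \mid \Diamond \mid \Box \mid \mathsf U \mid \mathsf R$; $\top$ abbreviates $\bot\to\bot$ and $\alpha\leftrightarrow\beta$ abbreviates $(\alpha\to\beta)\wedge(\beta\to\alpha)$. An intuitionistic dynamic model is $(W,\preccurlyeq,S,V)$ with $W\ne\varnothing$, $\preccurlyeq$ a partial order, $S\colon W\to W$ with $w\preccurlyeq v\Rightarrow S(w)\preccurlyeq S(v)$, and monotone $V\colon W\to\mathcal P(\mathbb P)$. Satisfaction: atoms by $V$; $\bot$ false; $\wedge,\vee$ classical; $w\models\bigcirc\varphi$ iff $S(w)\models\varphi$; $w\models\varphi\to\psi$ iff every $v\succcurlyeq w$ with $v\models\varphi$ has $v\models\psi$; $\Diamond\varphi$: some $S^k(w)\models\varphi$; $\Box\varphi$: all $S^k(w)\models\varphi$ ($k\ge0$); $w\models\varphi\,\mathsf U\,\psi$ iff some $k\ge0$ has $S^k(w)\models\psi$ and $S^i(w)\models\varphi$ for all $i\in[0,k)$; $w\models\varphi\,\mathsf R\,\psi$ iff for all $k\ge0$, $S^k(w)\models\psi$ or $S^i(w)\models\varphi$ for some $i\in[0,k)$. Valid: true at every world of every such model. -}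

module Defs where

open import Data.Nat using (ℕ; zero; suc; _<_)
open import Data.Product using (Σ; _×_)
open import Data.Sum using (_⊎_)
open import Data.Empty using (⊥)
open import Relation.Nullary using (¬_)
open import Relation.Binary.PropositionalEquality using (_≡_)
open import Relation.Binary.Structures using (IsPartialOrder)

infixr 20 _⇒_
infixr 22 _∨'_
infixr 23 _∧'_
infixr 24 _U_ _R_

data Form : Set where
  var  : ℕ → Form
  ⊥'   : Form
  _∧'_ : Form → Form → Form
  _∨'_ : Form → Form → Form
  _⇒_  : Form → Form → Form
  ○    : Form → Form
  ◇    : Form → Form
  □    : Form → Form
  _U_  : Form → Form → Form
  _R_  : Form → Form → Form

⊤' : Form
⊤' = ⊥' ⇒ ⊥'

_⇔_ : Form → Form → Form
α ⇔ β = (α ⇒ β) ∧' (β ⇒ α)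

iter : {A : Set} → (A → A) → ℕ → A → A
iter f zero    x = x
iter f (suc k) x = f (iter f k x)

record Model : Set₁ where
  field
    W      : Set
    _≼_    : W → W → Set
    isPO   : IsPartialOrder _≡_ _≼_
    S      : W → W
    S-mono : ∀ {w v} → w ≼ v → S w ≼ S v
    V      : W → ℕ → Set
    V-mono : ∀ {w v} → w ≼ v → ∀ p → V w p → V v p

module _ (M : Model) where
  open Model M

  _⊨_ : W → Form → Set
  w ⊨ var p   = V w p
  w ⊨ ⊥'      = ⊥
  w ⊨ (φ ∧' ψ) = (w ⊨ φ) × (w ⊨ ψ)
  w ⊨ (φ ∨' ψ) = (w ⊨ φ) ⊎ (w ⊨ ψ)
  w ⊨ (φ ⇒ ψ)  = ∀ v → w ≼ v → v ⊨ φ → v ⊨ ψ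
  w ⊨ ○ φ     = S w ⊨ φ
  w ⊨ ◇ φ     = Σ ℕ (λ k → iter S k w ⊨ φ)
  w ⊨ □ φ     = ∀ k → iter S k w ⊨ φ
  w ⊨ (φ U ψ)  = Σ ℕ (λ k → (iter S k w ⊨ ψ) × (∀ i → i < k → iter S i w ⊨ φ))
  w ⊨ (φ R ψ)  = ∀ k → (iter S k w ⊨ ψ) ⊎ Σ ℕ (λ i → (i < k) × (iter S i w ⊨ φ))

Valid : Form → Set₁
Valid φ = ∀ (M : Model) (w : Model.W M) → _⊨_ M w φ

-- Classical metatheory (the paper reasons classically about satisfaction)
ExcludedMiddle : Set₁
ExcludedMiddle = ∀ (P : Set) → P ⊎ ¬ P

-- Every clause is read off the satisfaction clauses of U and R along the
-- orbit w, S w, S² w, ….  The only facts beyond unfolding are that iterating S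
-- commutes with one more S (clauses 1, 2, 7, 8) and, for the classical
-- clauses 2, 9 and 10, excluded middle and the least-number principle it
-- yields: in 9 one looks at the first time ψ holds, in 10 at the first time
-- φ holds after ψ has failed somewhere.
module Submission where

open import Defs
open import Data.Product using (Σ; _×_; _,_; proj₁; proj₂)
open import Data.Sum using (_⊎_; inj₁; inj₂)
open import Data.Empty using (⊥-elim)
open import Data.Nat using (ℕ; zero; suc; _<_; _≤_; z<s; s<s)
open import Data.Nat.Properties using (<-cmp; <-≤-trans; <⇒≤; ≤-refl)
open import Data.Nat.Induction using (<-rec)
open import Relation.Binary.Definitions using (tri<; tri≈; tri>)
open import Relation.Binary.PropositionalEquality using (_≡_; refl; cong; subst; sym)
open import Relation.Nullary using (¬_)

IsLeast : (ℕ → Set) → ℕ → Set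
IsLeast P k = P k × (∀ i → i < k → ¬ P i)

least : ExcludedMiddle → (P : ℕ → Set) → ∀ n → P n → Σ ℕ (IsLeast P)
least lem P = <-rec (λ n → P n → Σ ℕ (IsLeast P)) step
  where
    step : ∀ n → (∀ {m} → m < n → P m → Σ ℕ (IsLeast P)) → P n → Σ ℕ (IsLeast P)
    step n below pn with lem (Σ ℕ λ m → m < n × P m)
    ... | inj₁ (m , m<n , pm) = below m<n pm
    ... | inj₂ none           = n , pn , λ i i<n pi → none (i , i<n , pi)

all⊎counterexample : ExcludedMiddle → (P : ℕ → Set) → (∀ k → P k) ⊎ Σ ℕ (λ k → ¬ P k)
all⊎counterexample lem P with lem (Σ ℕ λ k → ¬ P k)
... | inj₁ counterexample = inj₂ counterexample
... | inj₂ none           = inj₁ λ k → stable k (lem (P k))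
  where
    stable : ∀ k → P k ⊎ ¬ P k → P k
    stable k (inj₁ pk)  = pk
    stable k (inj₂ ¬pk) = ⊥-elim (none (k , ¬pk))

iter-shift : {A : Set} (f : A → A) → ∀ k x → iter f k (f x) ≡ f (iter f k x)
iter-shift f zero    x = refl
iter-shift f (suc k) x = cong f (iter-shift f k x)

infix 4 _⊫_

-- A record rather than a function type, so that α and β are recovered by
-- unification where an entailment is used.
record _⊫_ (α β : Form) : Set₁ where
  field
    entails : ∀ (M : Model) w → _⊨_ M w α → _⊨_ M w β
open _⊫_

valid-⇒ : ∀ {α β} → α ⊫ β → Valid (α ⇒ β)
valid-⇒ α⊫β M _ v _ = entails α⊫β M v

valid-⇔ : ∀ {α β} → α ⊫ β → β ⊫ α → Valid (α ⇔ β)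
valid-⇔ α⊫β β⊫α M w = valid-⇒ α⊫β M w , valid-⇒ β⊫α M w

⊫-refl : ∀ {α} → α ⊫ α
⊫-refl .entails M w a = a

∨-introˡ : ∀ {α β} → α ⊫ α ∨' β
∨-introˡ .entails M w = inj₁

∨-introʳ : ∀ {α β} → β ⊫ α ∨' β
∨-introʳ .entails M w = inj₂

∧-elimˡ : ∀ {α β} → α ∧' β ⊫ α
∧-elimˡ .entails M w = proj₁

∧-elimʳ : ∀ {α β} → α ∧' β ⊫ β
∧-elimʳ .entails M w = proj₂

∧-intro : ∀ {α β γ} → α ⊫ β → α ⊫ γ → α ⊫ β ∧' γ
∧-intro α⊫β α⊫γ .entails M w a = entails α⊫β M w a , entails α⊫γ M w a

∨-elim : ∀ {α β γ} → α ⊫ γ → β ⊫ γ → α ∨' β ⊫ γ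
∨-elim α⊫γ β⊫γ .entails M w (inj₁ a) = entails α⊫γ M w a
∨-elim α⊫γ β⊫γ .entails M w (inj₂ b) = entails β⊫γ M w b

holdsAt : (M : Model) → Model.W M → Form → ℕ → Set
holdsAt M w φ k = _⊨_ M (iter (Model.S M) k w) φ

module _ (M : Model) where
  open Model M

  private
    infix 4 _⊩_
    _⊩_ : W → Form → Set
    _⊩_ = _⊨_ M

  ○-iter : ∀ χ k w → iter S k (S w) ⊩ χ → iter S k w ⊩ ○ χ
  ○-iter χ k w = subst (_⊩ χ) (iter-shift S k w)

  ○-iter⁻¹ : ∀ χ k w → iter S k w ⊩ ○ χ → iter S k (S w) ⊩ χ
  ○-iter⁻¹ χ k w = subst (_⊩ χ) (sym (iter-shift S k w))

  R-step : ∀ {γ δ} w → w ⊩ γ R δ → ¬ w ⊩ γ → S w ⊩ γ R δ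
  R-step {γ} {δ} w r ¬γ k with r (suc k)
  ... | inj₁ δk                     = inj₁ (○-iter⁻¹ δ k w δk)
  ... | inj₂ (zero , _ , γ0)        = ⊥-elim (¬γ γ0)
  ... | inj₂ (suc i , s<s i<k , γi) = inj₂ (i , i<k , ○-iter⁻¹ γ i w γi)

  R-until-first : ∀ {γ δ} w k → w ⊩ γ R δ → (∀ i → i < k → ¬ holdsAt M w γ i) →
                  ∀ j → j ≤ k → holdsAt M w δ j
  R-until-first w k r none j j≤k with r j
  ... | inj₁ δj              = δj
  ... | inj₂ (i , i<j , γi) = ⊥-elim (none i (<-≤-trans i<j j≤k) γi)

U⇒R : ∀ {α β γ δ} → α ⊫ δ → β ⊫ δ → β ⊫ γ → α U β ⊫ γ R δ
U⇒R α⊫δ β⊫δ β⊫γ .entails M w (k , βk , α<k) j with <-cmp j k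
... | tri< j<k _ _  = inj₁ (entails α⊫δ M _ (α<k j j<k))
... | tri≈ _ refl _ = inj₁ (entails β⊫δ M _ βk)
... | tri> _ _ k<j  = inj₂ (k , k<j , entails β⊫γ M _ βk)

U-unfold : ∀ φ ψ → φ U ψ ⊫ ψ ∨' (φ ∧' ○ (φ U ψ))
U-unfold _ _ .entails M w (zero  , ψk , _)   = inj₁ ψk
U-unfold φ ψ .entails M w (suc k , ψk , φ<k) =
  inj₂ (φ<k 0 z<s , k , ○-iter⁻¹ M ψ k w ψk ,
        λ i i<k → ○-iter⁻¹ M φ i w (φ<k (suc i) (s<s i<k)))

U-fold : ∀ φ ψ → ψ ∨' (φ ∧' ○ (φ U ψ)) ⊫ φ U ψ
U-fold _ _ .entails M w (inj₁ ψ0)                 = zero , ψ0 , λ _ ()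
U-fold φ ψ .entails M w (inj₂ (φ0 , k , ψk , φ<k)) = suc k , ○-iter M ψ k w ψk , φ<suc
  where
    φ<suc : ∀ i → i < suc k → holdsAt M w φ i
    φ<suc zero    _         = φ0
    φ<suc (suc i) (s<s i<k) = ○-iter M φ i w (φ<k i i<k)

R-unfold : ExcludedMiddle → ∀ φ ψ → φ R ψ ⊫ ψ ∧' (φ ∨' ○ (φ R ψ))
R-unfold lem φ ψ .entails M w r with r 0 | lem (_⊨_ M w φ)
... | inj₂ (_ , () , _) | _
... | inj₁ ψ0           | inj₁ φ0 = ψ0 , inj₁ φ0
... | inj₁ ψ0           | inj₂ ¬φ0 = ψ0 , inj₂ (R-step M {φ} {ψ} w r ¬φ0)

R-fold : ∀ φ ψ → ψ ∧' (φ ∨' ○ (φ R ψ)) ⊫ φ R ψ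
R-fold _ _ .entails M w (ψ0 , _)      zero    = inj₁ ψ0
R-fold _ _ .entails M w (_ , inj₁ φ0) (suc k) = inj₂ (0 , z<s , φ0)
R-fold φ ψ .entails M w (_ , inj₂ r)  (suc k) with r k
... | inj₁ ψk              = inj₁ (○-iter M ψ k w ψk)
... | inj₂ (i , i<k , φi) = inj₂ (suc i , s<s i<k , ○-iter M φ i w φi)

U⇒◇ : ∀ φ ψ → φ U ψ ⊫ ◇ ψ
U⇒◇ _ _ .entails M w (k , ψk , _) = k , ψk

□⇒R : ∀ φ ψ → □ ψ ⊫ φ R ψ
□⇒R _ _ .entails M w □ψ k = inj₁ (□ψ k)

◇⇒⊤U : ∀ φ → ◇ φ ⊫ ⊤' U φ
◇⇒⊤U _ .entails M w (k , φk) = k , φk , λ _ _ _ _ ⊥ → ⊥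

⊥R⇒□ : ∀ φ → ⊥' R φ ⊫ □ φ
⊥R⇒□ _ .entails M w r k with r k
... | inj₁ φk = φk
... | inj₂ (_ , _ , ())

○U⇒U○ : ∀ φ ψ → ○ (φ U ψ) ⊫ ○ φ U ○ ψ
○U⇒U○ φ ψ .entails M w (k , ψk , φ<k) =
  k , ○-iter M ψ k w ψk , λ i i<k → ○-iter M φ i w (φ<k i i<k)

U○⇒○U : ∀ φ ψ → ○ φ U ○ ψ ⊫ ○ (φ U ψ)
U○⇒○U φ ψ .entails M w (k , ψk , φ<k) =
  k , ○-iter⁻¹ M ψ k w ψk , λ i i<k → ○-iter⁻¹ M φ i w (φ<k i i<k)

○R⇒R○ : ∀ φ ψ → ○ (φ R ψ) ⊫ ○ φ R ○ ψ
○R⇒R○ φ ψ .entails M w r k with r k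
... | inj₁ ψk              = inj₁ (○-iter M ψ k w ψk)
... | inj₂ (i , i<k , φi) = inj₂ (i , i<k , ○-iter M φ i w φi)

R○⇒○R : ∀ φ ψ → ○ φ R ○ ψ ⊫ ○ (φ R ψ)
R○⇒○R φ ψ .entails M w r k with r k
... | inj₁ ψk              = inj₁ (○-iter⁻¹ M ψ k w ψk)
... | inj₂ (i , i<k , φi) = inj₂ (i , i<k , ○-iter⁻¹ M φ i w φi)

R∧◇⇒U : ExcludedMiddle → ∀ φ ψ → (ψ R (φ ∨' ψ)) ∧' ◇ ψ ⊫ φ U ψ
R∧◇⇒U lem φ ψ .entails M w (r , m , ψm) with least lem (holdsAt M w ψ) m ψm
... | k , ψk , no-ψ<k = k , ψk , φ<k
  where
    φ<k : ∀ i → i < k → holdsAt M w φ i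
    φ<k i i<k with R-until-first M {ψ} {φ ∨' ψ} w k r no-ψ<k i (<⇒≤ i<k)
    ... | inj₁ φi = φi
    ... | inj₂ ψi = ⊥-elim (no-ψ<k i i<k ψi)

R⇒U∨□ : ExcludedMiddle → ∀ φ ψ → φ R ψ ⊫ (ψ U (φ ∧' ψ)) ∨' □ ψ
R⇒U∨□ lem φ ψ .entails M w r with all⊎counterexample lem (holdsAt M w ψ)
... | inj₁ □ψ = inj₂ □ψ
... | inj₂ (k , ¬ψk) with r k
...   | inj₁ ψk = ⊥-elim (¬ψk ψk)
...   | inj₂ (i₀ , _ , φi₀) with least lem (holdsAt M w φ) i₀ φi₀
...     | i , φi , no-φ<i =
  inj₁ (i , (φi , ψ≤i i ≤-refl) , λ j j<i → ψ≤i j (<⇒≤ j<i))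
  where
    ψ≤i : ∀ j → j ≤ i → holdsAt M w ψ j
    ψ≤i = R-until-first M {φ} {ψ} w i r no-φ<i

proposition2p4 : ExcludedMiddle → ∀ (φ ψ : Form) →
      Valid ((φ U ψ) ⇔ (ψ ∨' (φ ∧' ○ (φ U ψ))))
    × Valid ((φ R ψ) ⇔ (ψ ∧' (φ ∨' ○ (φ R ψ))))
    × Valid ((φ U ψ) ⇒ ◇ ψ)
    × Valid (□ ψ ⇒ (φ R ψ))
    × Valid (◇ φ ⇔ (⊤' U φ))
    × Valid (□ φ ⇔ (⊥' R φ))
    × Valid (○ (φ U ψ) ⇔ (○ φ U ○ ψ))
    × Valid (○ (φ R ψ) ⇔ (○ φ R ○ ψ))
    × Valid ((φ U ψ) ⇔ ((ψ R (φ ∨' ψ)) ∧' ◇ ψ))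
    × Valid ((φ R ψ) ⇔ ((ψ U (φ ∧' ψ)) ∨' □ ψ))
proposition2p4 lem φ ψ =
    valid-⇔ (U-unfold φ ψ) (U-fold φ ψ)
  , valid-⇔ (R-unfold lem φ ψ) (R-fold φ ψ)
  , valid-⇒ (U⇒◇ φ ψ)
  , valid-⇒ (□⇒R φ ψ)
  , valid-⇔ (◇⇒⊤U φ) (U⇒◇ ⊤' φ)
  , valid-⇔ (□⇒R ⊥' φ) (⊥R⇒□ φ)
  , valid-⇔ (○U⇒U○ φ ψ) (U○⇒○U φ ψ)
  , valid-⇔ (○R⇒R○ φ ψ) (R○⇒○R φ ψ)
  , valid-⇔ (∧-intro (U⇒R ∨-introˡ ∨-introʳ ⊫-refl) (U⇒◇ φ ψ)) (R∧◇⇒U lem φ ψ)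
  , valid-⇔ (R⇒U∨□ lem φ ψ) (∨-elim (U⇒R ⊫-refl ∧-elimʳ ∧-elimˡ) (□⇒R φ ψ))
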